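{- Let $\mathsf{CS}$ be an axiomatically appropriate constant specification for $\mathsf{JE}$, and let $\mathcal M^c=\langle W^c,N^c,\varepsilon^c\rangle$ be the canonical model defined by: $W^c=\mathsf{M}_{\mathsf{JE}}$ (the set of maximal $\mathsf{JE}_{\mathsf{CS}}$-consistent sets); $N^c(\Gamma)=\{\|H\|\mid[\mathsf{e}(\gamma)]H\in\Gamma\text{ for some proof term }\gamma\}$; $\varepsilon^c_\Gamma(P)=1$ iff $P\in\Gamma$ for $P\in\mathsf{Prop}$; $\varepsilon^c_\Gamma(t)=\{F\mid[t]F\in\Gamma\}$ for justification terms $t$; $\varepsilon^c_\Gamma(\lambda)=\{F\mid\lambda:F\in\Gamma\}$ for proof terms $\lambda$. Then for every formula $F$, $|F|^{\mathcal M^c}=\|F\|$.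
   Context: Fix countably many proof constants $\alpha_i$, proof variables $\xi_i$, and a countable set $\mathsf{Prop}$ of atomic propositions. Proof terms: $\lambda ::= \alpha_i \mid \xi_i \mid (\lambda\cdot\lambda) \mid (\lambda+\lambda) \mid\ !\lambda$. Justification terms: $t ::= \mathsf{e}(\lambda)$. Formulas: $F ::= P\mid\bot\mid(F\to F)\mid\lambda:F\mid[t]F$; other connectives are classical abbreviations. Axioms of $\mathsf{JE}$: all instances of classical propositional tautologies and of (j) $\lambda:(F\to G)\to(\kappa:F\to\lambda\cdot\kappa:G)$; (j+$_1$) $(\lambda:F\vee\kappa:F)\to(\lambda+\kappa):F$; (jt) $\lambda:F\to F$; (j4) $\lambda:F\to\ !\lambda:\lambda:F$; (je) $(\lambda:(F\to G)\wedge\lambda:(G\to F))\to([\mathsf{e}(\lambda)]F\to[\mathsf{e}(\lambda)]G)$; (je+) $([\mathsf{e}(\lambda)]F\vee[\mathsf{e}(\kappa)]F)\to[\mathsf{e}(\lambda+\kappa)]F$. A constant specification $\mathsf{CS}$ is a set of pairs $(\alpha,A)$, $\alpha$ a proof constant, $A$ an axiom of $\mathsf{JE}$; axiomatically appropriate means each axiom $A$ has some $\alpha$ with $(\alpha,A)\in\mathsf{CS}$. $\mathsf{JE}_{\mathsf{CS}}$ is the Hilbert system with these axioms, modus ponens, and axiom necessitation (infer $\alpha:A$ whenever $(\alpha,A)\in\mathsf{CS}$). A set $\Gamma$ is $\mathsf{JE}_{\mathsf{CS}}$-consistent if $\mathsf{JE}_{\mathsf{CS}}\nvdash\bigwedge\Sigma\to\bot$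 for every finite $\Sigma\subseteq\Gamma$; maximal consistent if consistent with no consistent proper superset. $\|F\|=\{\Gamma\in\mathsf{M}_{\mathsf{JE}}\mid F\in\Gamma\}$. In a structure $\langle W,N,\varepsilon\rangle$ (with each $\varepsilon_w$ assigning truth values to atoms and sets of formulas to terms), truth is: $w\nVdash\bot$; $w\Vdash P$ iff $\varepsilon_w(P)=1$; $w\Vdash F\to G$ iff $w\nVdash F$ or $w\Vdash G$; $w\Vdash\lambda:F$ iff $F\in\varepsilon_w(\lambda)$; $w\Vdash[t]F$ iff $F\in\varepsilon_w(t)$; and $|F|^{\mathcal M}=\{w\in W\mid w\Vdash F\}$. -}

module Defs where

open import Data.Nat using (ℕ)
open import Data.Bool using (Bool; true; false; not; _∨_)
open import Data.Product using (Σ; _×_; ∃)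
open import Data.Sum using (_⊎_)
open import Data.List using (List; []; _∷_)
open import Data.List.Relation.Unary.All using (All)
open import Data.Empty using (⊥)
open import Relation.Nullary using (¬_)
open import Relation.Binary.PropositionalEquality using (_≡_)
open import Function.Bundles using (_⇔_)

data PTerm : Set where
  const : ℕ → PTerm
  var   : ℕ → PTerm
  _·_   : PTerm → PTerm → PTerm
  _+_   : PTerm → PTerm → PTerm
  !_    : PTerm → PTerm

data JTerm : Set where
  e : PTerm → JTerm

infixr 5 _⇒_
infix 8 _∶_
infix 8 [_]_
infixr 6 _∨'_
infixr 7 _∧'_
data Formula : Set where
  atom : ℕ → Formula
  ⊥'   : Formula
  _⇒_  : Formula → Formula → Formula
  _∶_  : PTerm → Formula → Formula
  [_]_ : JTerm → Formula → Formula

¬' : Formula → Formula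
¬' F = F ⇒ ⊥'

⊤' : Formula
⊤' = ⊥' ⇒ ⊥'

_∨'_ : Formula → Formula → Formula
F ∨' G = ¬' F ⇒ G

_∧'_ : Formula → Formula → Formula
F ∧' G = ¬' (F ⇒ ¬' G)

-- Instances of classical propositional tautologies:
-- formulas true under every Boolean valuation of their prime
-- (non-implicational, non-⊥) subformulas.

eval : (Formula → Bool) → Formula → Bool
eval v (atom P) = v (atom P)
eval v ⊥'       = false
eval v (F ⇒ G)  = not (eval v F) ∨ eval v G
eval v (l ∶ F)  = v (l ∶ F)
eval v ([ t ] F) = v ([ t ] F)

Tautology : Formula → Set
Tautology F = (v : Formula → Bool) → eval v F ≡ true

data Axiom : Formula → Set where
  taut : ∀ {F} → Tautology F → Axiom F
  j    : ∀ l k F G → Axiom (l ∶ (F ⇒ G) ⇒ (k ∶ F ⇒ (l · k) ∶ G))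
  j+₁  : ∀ l k F → Axiom ((l ∶ F ∨' k ∶ F) ⇒ (l + k) ∶ F)
  jt   : ∀ l F → Axiom (l ∶ F ⇒ F)
  j4   : ∀ l F → Axiom (l ∶ F ⇒ (! l) ∶ (l ∶ F))
  je   : ∀ l F G → Axiom ((l ∶ (F ⇒ G) ∧' l ∶ (G ⇒ F))
                           ⇒ ([ e l ] F ⇒ [ e l ] G))
  je+  : ∀ l k F → Axiom (([ e l ] F ∨' [ e k ] F) ⇒ [ e (l + k) ] F)

-- A constant specification: a set of pairs (α_i, A) with A an axiom.
-- The constant α_i is represented by its index i.
ConstSpec : Set₁
ConstSpec = ℕ → Formula → Set

IsConstSpec : ConstSpec → Set
IsConstSpec CS = ∀ i A → CS i A → Axiom A

AxiomaticallyAppropriate : ConstSpec → Set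
AxiomaticallyAppropriate CS = ∀ A → Axiom A → ∃ λ i → CS i A

infix 3 _⊢_
data _⊢_ (CS : ConstSpec) : Formula → Set where
  ax  : ∀ {A} → Axiom A → CS ⊢ A
  mp  : ∀ {F G} → CS ⊢ (F ⇒ G) → CS ⊢ F → CS ⊢ G
  nec : ∀ {i A} → CS i A → CS ⊢ (const i ∶ A)

FSet : Set₁
FSet = Formula → Set

_⊆_ : FSet → FSet → Set
Γ ⊆ Δ = ∀ F → Γ F → Δ F

⋀ : List Formula → Formula
⋀ []       = ⊤'
⋀ (F ∷ Fs) = F ∧' ⋀ Fs

Consistent : ConstSpec → FSet → Set
Consistent CS Γ = (Σs : List Formula) → All Γ Σs → ¬ (CS ⊢ (⋀ Σs ⇒ ⊥'))

MaxConsistent : ConstSpec → FSet → Set₁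
MaxConsistent CS Γ =
  Consistent CS Γ × ((Δ : FSet) → Γ ⊆ Δ → Consistent CS Δ → Δ ⊆ Γ)

MCS : ConstSpec → Set₁
MCS CS = Σ FSet (MaxConsistent CS)

record Structure : Set₂ where
  field
    W   : Set₁
    N   : W → (W → Set) → Set₁
    εP  : W → ℕ → Set
    εpt : W → PTerm → FSet
    εjt : W → JTerm → FSet

open Structure public

_∣_⊩_ : (M : Structure) → W M → Formula → Set
M ∣ w ⊩ atom P  = εP M w P
M ∣ w ⊩ ⊥'      = ⊥
M ∣ w ⊩ (F ⇒ G) = M ∣ w ⊩ F → M ∣ w ⊩ G
M ∣ w ⊩ (l ∶ F) = εpt M w l F
M ∣ w ⊩ ([ t ] F) = εjt M w t F

∣_∣^_ : Formula → (M : Structure) → W M → Set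
(∣ F ∣^ M) w = M ∣ w ⊩ F

‖_‖ : {CS : ConstSpec} → Formula → MCS CS → Set
‖ F ‖ Γ = Data.Product.proj₁ Γ F

Canonical : ConstSpec → Structure
Canonical CS = record
  { W   = MCS CS
  ; N   = λ Γ X → Σ PTerm λ γ → Σ Formula λ H →
            Data.Product.proj₁ Γ ([ e γ ] H) × ((Δ : MCS CS) → X Δ ⇔ ‖ H ‖ Δ)
  ; εP  = λ Γ P → Data.Product.proj₁ Γ (atom P)
  ; εpt = λ Γ l F → Data.Product.proj₁ Γ (l ∶ F)
  ; εjt = λ Γ t F → Data.Product.proj₁ Γ ([ t ] F)
  }

{-# OPTIONS --safe #-}
-- Atoms, λ : F and [t]F hold at a world Γ of the canonical model exactly when
-- they belong to Γ, because ε^c reads membership off Γ; so only ⊥ and → need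
-- an argument. Both rest on two properties of a maximal consistent set Γ: it is
-- closed under derivation from finitely many of its members, and it contains
-- every X for which it does not derive ¬X (else Γ ∪ {X} would be a consistent
-- proper extension). For F → G: were ¬(F → G) derivable from Γ, then so would
-- be F and ¬G; thus F ∈ Γ, hence G ∈ Γ, and Γ would derive ⊥.
module Submission where

open import Defs
open import Data.Bool using (Bool; true; false; T; not; _∨_)
open import Data.Bool.Properties using (T-≡)
open import Data.Empty using (⊥-elim)
open import Data.Fin using (Fin; zero; suc)
open import Data.List using (List; []; _∷_; _++_)
open import Data.List.Relation.Unary.All using (All; []; _∷_)
open import Data.List.Relation.Unary.All.Properties using (++⁺)
open import Data.Nat using (ℕ; zero; suc)
open import Data.Product using (Σ; _×_; _,_; proj₁; proj₂)
open import Data.Sum using (_⊎_; inj₁; inj₂)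
open import Data.Vec using (Vec; []; _∷_; lookup; map)
open import Data.Vec.Properties using (lookup-map)
open import Function using (_∘_; id)
open import Function.Bundles using (_⇔_; mk⇔; Equivalence)
open import Relation.Binary.PropositionalEquality using (_≡_; refl; sym; cong₂; trans)
open import Relation.Nullary using (¬_)

infixr 5 _⇒ˢ_
infixr 7 _∧ˢ_

data Schema (n : ℕ) : Set where
  ‵_   : Fin n → Schema n
  ⊥ˢ   : Schema n
  _⇒ˢ_ : Schema n → Schema n → Schema n

p : ∀ {n} → Schema (suc n)
p = ‵ zero

q : ∀ {n} → Schema (suc (suc n))
q = ‵ suc zero

r : ∀ {n} → Schema (suc (suc (suc n)))
r = ‵ suc (suc zero)

s : ∀ {n} → Schema (suc (suc (suc (suc n))))
s = ‵ suc (suc (suc zero))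

u : ∀ {n} → Schema (suc (suc (suc (suc (suc n)))))
u = ‵ suc (suc (suc (suc zero)))

¬ˢ : ∀ {n} → Schema n → Schema n
¬ˢ S = S ⇒ˢ ⊥ˢ

⊤ˢ : ∀ {n} → Schema n
⊤ˢ = ¬ˢ ⊥ˢ

_∧ˢ_ : ∀ {n} → Schema n → Schema n → Schema n
S ∧ˢ R = ¬ˢ (S ⇒ˢ ¬ˢ R)

_⟦_⟧ : ∀ {n} → Schema n → Vec Formula n → Formula
(‵ i)    ⟦ σ ⟧ = lookup σ i
⊥ˢ       ⟦ σ ⟧ = ⊥'
(S ⇒ˢ R) ⟦ σ ⟧ = S ⟦ σ ⟧ ⇒ R ⟦ σ ⟧

evalˢ : ∀ {n} → Vec Bool n → Schema n → Bool
evalˢ bs (‵ i)    = lookup bs i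
evalˢ bs ⊥ˢ       = false
evalˢ bs (S ⇒ˢ R) = not (evalˢ bs S) ∨ evalˢ bs R

eval-⟦⟧ : ∀ {n} (v : Formula → Bool) (S : Schema n) (σ : Vec Formula n) →
          eval v (S ⟦ σ ⟧) ≡ evalˢ (map (eval v) σ) S
eval-⟦⟧ v (‵ i)    σ = sym (lookup-map i (eval v) σ)
eval-⟦⟧ v ⊥ˢ       σ = refl
eval-⟦⟧ v (S ⇒ˢ R) σ = cong₂ (λ a b → not a ∨ b) (eval-⟦⟧ v S σ) (eval-⟦⟧ v R σ)

Valid : ∀ n → (Vec Bool n → Bool) → Set
Valid zero    f = T (f [])
Valid (suc n) f = Valid n (f ∘ (true ∷_)) × Valid n (f ∘ (false ∷_))

valid-sound : ∀ {n} (f : Vec Bool n → Bool) → Valid n f → ∀ bs → f bs ≡ true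
valid-sound {zero}  f valid       []           = Equivalence.to T-≡ valid
valid-sound {suc n} f (valid , _) (true ∷ bs)  = valid-sound (f ∘ (true ∷_)) valid bs
valid-sound {suc n} f (_ , valid) (false ∷ bs) = valid-sound (f ∘ (false ∷_)) valid bs

-- The validity witness is a nested product of ⊤, found by η once S is given.
tautology-instance : ∀ {n} (S : Schema n) {valid : Valid n (λ bs → evalˢ bs S)} →
                     (σ : Vec Formula n) → Tautology (S ⟦ σ ⟧)
tautology-instance S {valid} σ v =
  trans (eval-⟦⟧ v S σ) (valid-sound (λ bs → evalˢ bs S) valid (map (eval v) σ))

module Derivation (CS : ConstSpec) where

  ⊢-instance : ∀ {n} (S : Schema n) {valid : Valid n (λ bs → evalˢ bs S)} →
               (σ : Vec Formula n) → CS ⊢ S ⟦ σ ⟧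
  ⊢-instance S {valid} σ = ax (taut (tautology-instance S {valid} σ))

  mp₂ : ∀ {A B C} → CS ⊢ A ⇒ B ⇒ C → CS ⊢ A → CS ⊢ B → CS ⊢ C
  mp₂ d a b = mp (mp d a) b

  ⋀-++ : ∀ Σ₁ Σ₂ → CS ⊢ ⋀ (Σ₁ ++ Σ₂) ⇒ ⋀ Σ₁ ∧' ⋀ Σ₂
  ⋀-++ []       Σ₂ = ⊢-instance (p ⇒ˢ ⊤ˢ ∧ˢ p) (⋀ Σ₂ ∷ [])
  ⋀-++ (H ∷ Σ₁) Σ₂ =
    mp (⊢-instance ((p ⇒ˢ q ∧ˢ r) ⇒ˢ s ∧ˢ p ⇒ˢ (s ∧ˢ q) ∧ˢ r)
                   (⋀ (Σ₁ ++ Σ₂) ∷ ⋀ Σ₁ ∷ ⋀ Σ₂ ∷ H ∷ []))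
       (⋀-++ Σ₁ Σ₂)

  infix 3 _⊢ₛ_

  _⊢ₛ_ : FSet → Formula → Set
  Γ ⊢ₛ F = Σ (List Formula) λ Σs → All Γ Σs × CS ⊢ ⋀ Σs ⇒ F

  module _ {Γ : FSet} where

    ⊢ₛ-theorem : ∀ {F} → CS ⊢ F → Γ ⊢ₛ F
    ⊢ₛ-theorem {F} d = [] , [] , mp (⊢-instance (p ⇒ˢ q ⇒ˢ p) (F ∷ ⊤' ∷ [])) d

    ⊢ₛ-member : ∀ {F} → Γ F → Γ ⊢ₛ F
    ⊢ₛ-member {F} γ = F ∷ [] , γ ∷ [] , ⊢-instance (p ∧ˢ ⊤ˢ ⇒ˢ p) (F ∷ [])

    ⊢ₛ-mp : ∀ {F G} → Γ ⊢ₛ F ⇒ G → Γ ⊢ₛ F → Γ ⊢ₛ G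
    ⊢ₛ-mp {F} {G} (Σ₁ , γ₁ , d₁) (Σ₂ , γ₂ , d₂) =
      Σ₁ ++ Σ₂ , ++⁺ γ₁ γ₂ ,
      mp (mp₂ (⊢-instance ((p ⇒ˢ r ⇒ˢ s) ⇒ˢ (q ⇒ˢ r) ⇒ˢ (u ⇒ˢ p ∧ˢ q) ⇒ˢ u ⇒ˢ s)
                          (⋀ Σ₁ ∷ ⋀ Σ₂ ∷ F ∷ G ∷ ⋀ (Σ₁ ++ Σ₂) ∷ []))
              d₁ d₂)
         (⋀-++ Σ₁ Σ₂)

    ⊢ₛ-instance : ∀ {n} (S : Schema n) {valid : Valid n (λ bs → evalˢ bs S)} →
                  (σ : Vec Formula n) → Γ ⊢ₛ S ⟦ σ ⟧
    ⊢ₛ-instance S {valid} σ = ⊢ₛ-theorem (⊢-instance S {valid} σ)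

  _∪｛_｝ : FSet → Formula → FSet
  (Γ ∪｛ X ｝) H = Γ H ⊎ H ≡ X

  module _ {Γ : FSet} {X : Formula} where

    ⊢ₛ-⇒member : ∀ {H} → (Γ ∪｛ X ｝) H → Γ ⊢ₛ X ⇒ H
    ⊢ₛ-⇒member {H} (inj₁ γ) = ⊢ₛ-mp (⊢ₛ-instance (p ⇒ˢ q ⇒ˢ p) (H ∷ X ∷ [])) (⊢ₛ-member γ)
    ⊢ₛ-⇒member (inj₂ refl)  = ⊢ₛ-instance (p ⇒ˢ p) (X ∷ [])

    ⊢ₛ-⇒⋀ : ∀ Σs → All (Γ ∪｛ X ｝) Σs → Γ ⊢ₛ X ⇒ ⋀ Σs
    ⊢ₛ-⇒⋀ []       []       = ⊢ₛ-instance (p ⇒ˢ ⊤ˢ) (X ∷ [])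
    ⊢ₛ-⇒⋀ (H ∷ Σs) (h ∷ hs) =
      ⊢ₛ-mp (⊢ₛ-mp (⊢ₛ-instance ((p ⇒ˢ q) ⇒ˢ (p ⇒ˢ r) ⇒ˢ p ⇒ˢ q ∧ˢ r) (X ∷ H ∷ ⋀ Σs ∷ []))
                   (⊢ₛ-⇒member h))
            (⊢ₛ-⇒⋀ Σs hs)

    ⊢ₛ-¬-of-refuted : ∀ Σs → All (Γ ∪｛ X ｝) Σs → CS ⊢ ⋀ Σs ⇒ ⊥' → Γ ⊢ₛ ¬' X
    ⊢ₛ-¬-of-refuted Σs hs d =
      ⊢ₛ-mp (⊢ₛ-mp (⊢ₛ-instance ((p ⇒ˢ q) ⇒ˢ (q ⇒ˢ ⊥ˢ) ⇒ˢ ¬ˢ p) (X ∷ ⋀ Σs ∷ []))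
                   (⊢ₛ-⇒⋀ Σs hs))
            (⊢ₛ-theorem d)

module MaxConsistentSet {CS : ConstSpec} {Γ : FSet} (mc : MaxConsistent CS Γ) where

  open Derivation CS

  ⊬⊥ : ¬ (Γ ⊢ₛ ⊥')
  ⊬⊥ (Σs , γs , d) = proj₁ mc Σs γs d

  ∈-of-⊬¬ : ∀ {X} → ¬ (Γ ⊢ₛ ¬' X) → Γ X
  ∈-of-⊬¬ {X} ⊬¬X = proj₂ mc (Γ ∪｛ X ｝) (λ _ → inj₁) consistent X (inj₂ refl)
    where
    consistent : Consistent CS (Γ ∪｛ X ｝)
    consistent Σs hs d = ⊬¬X (⊢ₛ-¬-of-refuted Σs hs d)

  ∈-of-⊢ₛ : ∀ {F} → Γ ⊢ₛ F → Γ F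
  ∈-of-⊢ₛ ⊢F = ∈-of-⊬¬ (λ ⊢¬F → ⊬⊥ (⊢ₛ-mp ⊢¬F ⊢F))

  ⇒-elim : ∀ {F G} → Γ (F ⇒ G) → Γ F → Γ G
  ⇒-elim F⇒G∈Γ F∈Γ = ∈-of-⊢ₛ (⊢ₛ-mp (⊢ₛ-member F⇒G∈Γ) (⊢ₛ-member F∈Γ))

  ⇒-intro : ∀ {F G} → (Γ F → Γ G) → Γ (F ⇒ G)
  ⇒-intro {F} {G} F→G = ∈-of-⊬¬ λ ⊢¬[F⇒G] →
    let ⊢F  = ⊢ₛ-mp (⊢ₛ-instance (¬ˢ (p ⇒ˢ q) ⇒ˢ p) (F ∷ G ∷ [])) ⊢¬[F⇒G]
        ⊢¬G = ⊢ₛ-mp (⊢ₛ-instance (¬ˢ (p ⇒ˢ q) ⇒ˢ ¬ˢ q) (F ∷ G ∷ [])) ⊢¬[F⇒G]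
    in  ⊬⊥ (⊢ₛ-mp ⊢¬G (⊢ₛ-member (F→G (∈-of-⊢ₛ ⊢F))))

truth-lemma : ∀ {CS} (F : Formula) (Γ : MCS CS) → (∣ F ∣^ Canonical CS) Γ ⇔ ‖ F ‖ Γ
truth-lemma (atom P) Γ = mk⇔ id id
truth-lemma {CS} ⊥' (Γ , mc) = mk⇔ ⊥-elim (⊬⊥ ∘ ⊢ₛ-member)
  where
  open Derivation CS
  open MaxConsistentSet mc
truth-lemma {CS} (F ⇒ G) (Γ , mc) =
  mk⇔ (λ h → ⇒-intro (to G ∘ h ∘ from F)) (λ g → from G ∘ ⇒-elim g ∘ to F)
  where
  open MaxConsistentSet mc
  to : ∀ H → (∣ H ∣^ Canonical CS) (Γ , mc) → Γ H
  to H = Equivalence.to (truth-lemma H (Γ , mc))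
  from : ∀ H → Γ H → (∣ H ∣^ Canonical CS) (Γ , mc)
  from H = Equivalence.from (truth-lemma H (Γ , mc))
truth-lemma (l ∶ F) Γ = mk⇔ id id
truth-lemma ([ t ] F) Γ = mk⇔ id id

mainTheorem12 : (CS : ConstSpec) → IsConstSpec CS → AxiomaticallyAppropriate CS →
    (F : Formula) → (Γ : MCS CS) → (∣ F ∣^ Canonical CS) Γ ⇔ ‖ F ‖ Γ
mainTheorem12 CS _ _ = truth-lemma
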